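{- Every cyclic permutation of an ins-robust primitive word is ins-robust primitive: if $xy \in Q_I$ with $x, y \in V^*$, then $yx \in Q_I$.
   Context: $V$ is a finite alphabet with at least two distinct letters; $V^*$ is the set of all finite words over $V$ (including the empty word). A nonempty word $w$ is primitive if it is not of the form $v^n$ for a word $v$ and an integer $n \ge 2$. For a word $w$ of length $n$, $w[1..i]$ denotes its prefix of length $i$ and $w[i+1..n]$ its suffix of length $n-i$. A primitive word $w$ of length $n$ is ins-robust if for every $i \in \{0,\ldots,n\}$ and every $a \in V$ the word $w[1..i]\,a\,w[i+1..n]$ is primitive; $Q_I$ is the set of ins-robust primitive words. A cyclic permutation of a word $z$ is any word $yx$ where $z = xy$. -}

module Defs where

open import Data.Nat using (ℕ; zero; suc; _≤_)
open import Data.Fin using (Fin)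
open import Data.List using (List; []; _∷_; _++_; length; take; drop)
open import Data.Product using (∃; ∃-syntax; _×_)
open import Relation.Binary.PropositionalEquality using (_≡_)
open import Relation.Nullary using (¬_)

Word : Set → Set
Word V = List V

_^ʷ_ : {V : Set} → Word V → ℕ → Word V
v ^ʷ zero  = []
v ^ʷ suc n = v ++ (v ^ʷ n)

Primitive : {V : Set} → Word V → Set
Primitive w = ¬ (w ≡ []) × ¬ (∃[ v ] ∃[ n ] (2 ≤ n × w ≡ v ^ʷ n))

insertAt : {V : Set} → ℕ → V → Word V → Word V
insertAt i a w = take i w ++ (a ∷ drop i w)

InsRobust : {V : Set} → Word V → Set
InsRobust {V} w = Primitive w × ((i : ℕ) → i ≤ length w → (a : V) → Primitive (insertAt i a w))

module Submission where

-- A word is a proper power exactly when one of its cyclic permutations is, so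
-- rotation preserves primitivity.  Inserting a letter into yx at a position inside y
-- (resp. x) yields a cyclic permutation of the word obtained from xy by inserting the
-- same letter inside y (resp. x); the latter is primitive because xy is ins-robust.

open import Defs
open import Data.Nat using (ℕ; zero; suc; _+_; _≤_; z≤n; s≤s)
open import Data.Fin using (Fin)
open import Data.List using (List; []; _∷_; _++_; [_]; length)
open import Data.List.Properties using (++-assoc; ++-identityʳ; length-++; length-++-≤ˡ)
open import Data.Nat.Properties using (≤-trans; ≤-reflexive; +-monoʳ-≤)
open import Data.Product using (∃-syntax; _×_; _,_)
open import Data.Sum using (_⊎_; inj₁; inj₂)
open import Relation.Binary.PropositionalEquality
  using (_≡_; refl; sym; trans; cong; subst; module ≡-Reasoning)
open import Relation.Nullary using (¬_)

private
  variable
    V : Set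

IsProperPower : Word V → Set
IsProperPower w = ∃[ v ] ∃[ n ] (2 ≤ n × w ≡ v ^ʷ n)

[]^ʷ : (n : ℕ) → ([] {A = V}) ^ʷ n ≡ []
[]^ʷ zero    = refl
[]^ʷ (suc n) = []^ʷ n

^ʷ-++-shift : (s t : Word V) (n : ℕ) → (s ++ t) ^ʷ n ++ s ≡ s ++ (t ++ s) ^ʷ n
^ʷ-++-shift s t zero    = sym (++-identityʳ s)
^ʷ-++-shift s t (suc n) = begin
  ((s ++ t) ++ (s ++ t) ^ʷ n) ++ s  ≡⟨ ++-assoc (s ++ t) _ s ⟩
  (s ++ t) ++ (s ++ t) ^ʷ n ++ s    ≡⟨ cong ((s ++ t) ++_) (^ʷ-++-shift s t n) ⟩
  (s ++ t) ++ s ++ (t ++ s) ^ʷ n    ≡⟨ ++-assoc s t _ ⟩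
  s ++ t ++ s ++ (t ++ s) ^ʷ n      ≡⟨ cong (s ++_) (sym (++-assoc t s _)) ⟩
  s ++ (t ++ s) ^ʷ suc n            ∎
  where open ≡-Reasoning

isProperPower-rotate₁ : (a : V) (w : Word V) → IsProperPower (a ∷ w) → IsProperPower (w ++ [ a ])
isProperPower-rotate₁ a w ([] , suc n , 2≤n , eq) with trans eq ([]^ʷ n)
... | ()
isProperPower-rotate₁ a w ((b ∷ v) , suc n , 2≤n , refl) = v ++ [ a ] , suc n , 2≤n , (begin
  (v ++ (a ∷ v) ^ʷ n) ++ [ a ]    ≡⟨ ++-assoc v _ [ a ] ⟩
  v ++ (a ∷ v) ^ʷ n ++ [ a ]      ≡⟨ cong (v ++_) (^ʷ-++-shift [ a ] v n) ⟩
  v ++ [ a ] ++ (v ++ [ a ]) ^ʷ n ≡⟨ sym (++-assoc v [ a ] _) ⟩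
  (v ++ [ a ]) ^ʷ suc n            ∎)
  where open ≡-Reasoning

isProperPower-rotate : (x y : Word V) → IsProperPower (x ++ y) → IsProperPower (y ++ x)
isProperPower-rotate []      y p = subst IsProperPower (sym (++-identityʳ y)) p
isProperPower-rotate (a ∷ x) y p =
  subst IsProperPower (++-assoc y [ a ] x)
    (isProperPower-rotate x (y ++ [ a ])
      (subst IsProperPower (++-assoc x y [ a ]) (isProperPower-rotate₁ a (x ++ y) p)))

++-nonempty-swap : (x y : Word V) → ¬ (x ++ y ≡ []) → ¬ (y ++ x ≡ [])
++-nonempty-swap []      []      x++y≢[] = x++y≢[]
++-nonempty-swap (_ ∷ _) []      _       ()
++-nonempty-swap _       (_ ∷ _) _       ()

primitive-rotate : (x y : Word V) → Primitive (x ++ y) → Primitive (y ++ x)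
primitive-rotate x y (x++y≢[] , ¬power) =
  ++-nonempty-swap x y x++y≢[] , λ power → ¬power (isProperPower-rotate y x power)

insertAt-++ˡ : (a : V) (i : ℕ) (x y : Word V) → i ≤ length x →
               insertAt i a (x ++ y) ≡ insertAt i a x ++ y
insertAt-++ˡ a zero    x       y _         = refl
insertAt-++ˡ a (suc i) (b ∷ x) y (s≤s i≤x) = cong (b ∷_) (insertAt-++ˡ a i x y i≤x)

insertAt-++ʳ : (a : V) (j : ℕ) (x y : Word V) →
               insertAt (length x + j) a (x ++ y) ≡ x ++ insertAt j a y
insertAt-++ʳ a j []      y = refl
insertAt-++ʳ a j (b ∷ x) y = cong (b ∷_) (insertAt-++ʳ a j x y)

position-++ : (x y : Word V) (i : ℕ) → i ≤ length (x ++ y) →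
              i ≤ length x ⊎ ∃[ j ] (j ≤ length y × i ≡ length x + j)
position-++ []      y i       i≤y        = inj₂ (i , i≤y , refl)
position-++ (b ∷ x) y zero    _          = inj₁ z≤n
position-++ (b ∷ x) y (suc i) (s≤s i≤xy) with position-++ x y i i≤xy
... | inj₁ i≤x              = inj₁ (s≤s i≤x)
... | inj₂ (j , j≤y , refl) = inj₂ (j , j≤y , refl)

insRobust-rotate : (x y : Word V) → InsRobust (x ++ y) → InsRobust (y ++ x)
insRobust-rotate {V} x y (xy-primitive , robust) = primitive-rotate x y xy-primitive , inserted
  where
  inserted : (i : ℕ) → i ≤ length (y ++ x) → (a : V) → Primitive (insertAt i a (y ++ x))
  inserted i i≤yx a with position-++ y x i i≤yx
  ... | inj₁ i≤y =
    subst Primitive (sym (insertAt-++ˡ a i y x i≤y))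
      (primitive-rotate x (insertAt i a y)
        (subst Primitive (insertAt-++ʳ a i x y) (robust (length x + i) x+i≤xy a)))
    where
    x+i≤xy : length x + i ≤ length (x ++ y)
    x+i≤xy = ≤-trans (+-monoʳ-≤ (length x) i≤y) (≤-reflexive (sym (length-++ x)))
  ... | inj₂ (j , j≤x , refl) =
    subst Primitive (sym (insertAt-++ʳ a j y x))
      (primitive-rotate (insertAt j a x) y
        (subst Primitive (insertAt-++ˡ a j x y j≤x)
          (robust j (≤-trans j≤x (length-++-≤ˡ x)) a)))

corollary14 : (k : ℕ) → 2 ≤ k → (x y : List (Fin k)) →
              InsRobust (x ++ y) → InsRobust (y ++ x)
corollary14 _ _ = insRobust-rotate
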